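{- An extended system is complete if and only if it contains $\mathbf{Mp}$.
   Context: Formulas are built from literals (propositional variables $P$ and their complements $\bar P$) using $\wedge$ and $\vee$. Negation satisfies $\neg P=\bar P$ and is extended by De Morgan's laws. A sequent is a nonempty finite multiset of formulas. A comma denotes multiset union, and $\Gamma,\Delta,\Sigma$ denote possibly empty multisets. A formula is valid if it evaluates to $1$ under every $0/1$-assignment. Rules: - Axiom: infer $P,\neg P$ from no premises. - $(\&)$: from $\Gamma,A$ and $\Gamma,B$ infer $\Gamma,A\wedge B$. - $(\otimes)$: from $\Delta,A$ and $\Sigma,B$ infer $\Delta,\Sigma,A\wedge B$. - $(\wedge)$: from $\Gamma,\Delta,A$ and $\Gamma,\Sigma,B$ infer $\Gamma,\Delta,\Sigma,A\wedge B$. - $(\oplus_i)$ for $i=1,2$: from $\Gamma,A_i$ infer $\Gamma,A_1\vee A_2$. - $(\mathrm{par})$: from $\Gamma,A,B$ infer $\Gamma,A\vee B$. - $(\mathsf W)$: from $\Gamma$ infer $\Gamma,A$. - $(\mathsf C)$: from $\Gamma,A,A$ infer $\Gamma,A$. An extended system is the axiom together with any subset of $\{(\otimes),(\wedge),(\&),(\oplus),(\mathrm{par}),(\mathsf C),(\mathsf W)\}$, where $(\oplus)$ denotes the pair $(\oplus_1),(\oplus_2)$. $\mathbf{Mp}$ is the axiom together with $(\wedge),(\oplus),(\mathrm{par})$. A rule is derivable in $S$ if, for every instance of it, the conclusion is derivable in $S$ from its premises used as extra leaves. $S$ contains $T$ if every rule of $T$ is derivable in $S$. A system is complete if every valid formula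 is derivable in it. -}

module Defs where

open import Data.Nat using (ℕ)
open import Data.Bool using (Bool; true; false; not; _∧_; _∨_)
open import Data.List using (List; []; _∷_; _++_; [_])
open import Data.List.Relation.Unary.All using (All)
open import Data.List.Membership.Propositional using (_∈_)
open import Data.List.Relation.Binary.Permutation.Propositional using (_↭_)
open import Relation.Binary.PropositionalEquality using (_≡_; _≢_)
open import Function.Bundles using (_⇔_)

data Literal : Set where
  pos : ℕ → Literal
  neg : ℕ → Literal

data Formula : Set where
  lit  : Literal → Formula
  _⋀_  : Formula → Formula → Formula
  _⋁_  : Formula → Formula → Formula

infixr 6 _⋀_
infixr 5 _⋁_

neg-lit : Literal → Literal
neg-lit (pos x) = neg x
neg-lit (neg x) = pos x

¬f : Formula → Formula
¬f (lit l)  = lit (neg-lit l)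
¬f (A ⋀ B) = ¬f A ⋁ ¬f B
¬f (A ⋁ B) = ¬f A ⋀ ¬f B

evalLit : (ℕ → Bool) → Literal → Bool
evalLit ρ (pos x) = ρ x
evalLit ρ (neg x) = not (ρ x)

eval : (ℕ → Bool) → Formula → Bool
eval ρ (lit l)  = evalLit ρ l
eval ρ (A ⋀ B) = eval ρ A ∧ eval ρ B
eval ρ (A ⋁ B) = eval ρ A ∨ eval ρ B

Valid : Formula → Set
Valid A = ∀ (ρ : ℕ → Bool) → eval ρ A ≡ true

-- Sequents: finite multisets of formulas, represented by lists considered
-- up to permutation (see the `perm` constructor of Der below).
Sequent : Set
Sequent = List Formula

-- The structural/logical rules (besides the axiom). `⊕r` stands for the
-- pair (⊕₁),(⊕₂).
data Rule : Set where
  ⊗r ∧r &r ⊕r par C W : Rule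

data Instance : Rule → List Sequent → Sequent → Set where
  inst-& : ∀ Γ A B →
    Instance &r ((Γ ++ [ A ]) ∷ (Γ ++ [ B ]) ∷ []) (Γ ++ [ A ⋀ B ])
  inst-⊗ : ∀ Δ Σ A B →
    Instance ⊗r ((Δ ++ [ A ]) ∷ (Σ ++ [ B ]) ∷ []) (Δ ++ Σ ++ [ A ⋀ B ])
  inst-∧ : ∀ Γ Δ Σ A B →
    Instance ∧r ((Γ ++ Δ ++ [ A ]) ∷ (Γ ++ Σ ++ [ B ]) ∷ [])
                (Γ ++ Δ ++ Σ ++ [ A ⋀ B ])
  inst-⊕₁ : ∀ Γ A₁ A₂ →
    Instance ⊕r ((Γ ++ [ A₁ ]) ∷ []) (Γ ++ [ A₁ ⋁ A₂ ])
  inst-⊕₂ : ∀ Γ A₁ A₂ →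
    Instance ⊕r ((Γ ++ [ A₂ ]) ∷ []) (Γ ++ [ A₁ ⋁ A₂ ])
  inst-par : ∀ Γ A B →
    Instance par ((Γ ++ A ∷ B ∷ []) ∷ []) (Γ ++ [ A ⋁ B ])
  inst-W : ∀ Γ A → Γ ≢ [] →   -- the premise Γ is a (nonempty) sequent
    Instance W (Γ ∷ []) (Γ ++ [ A ])
  inst-C : ∀ Γ A →
    Instance C ((Γ ++ A ∷ A ∷ []) ∷ []) (Γ ++ [ A ])

-- An extended system: the axiom together with a subset of the rules.
System : Set
System = Rule → Bool

data Der (S : System) (H : List Sequent) : Sequent → Set where
  leaf : ∀ {Γ} → Γ ∈ H → Der S H Γ
  ax   : ∀ x → Der S H (lit (pos x) ∷ ¬f (lit (pos x)) ∷ [])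
  app  : ∀ {r ps c} → S r ≡ true → Instance r ps c → All (Der S H) ps →
         Der S H c
  perm : ∀ {Γ Δ} → Γ ↭ Δ → Der S H Γ → Der S H Δ

Mp : System
Mp ∧r  = true
Mp ⊕r  = true
Mp par = true
Mp _   = false

DerivableRule : System → Rule → Set
DerivableRule S r = ∀ ps c → Instance r ps c → Der S ps c

Contains : System → System → Set
Contains S T = ∀ r → T r ≡ true → DerivableRule S r

Complete : System → Set
Complete S = ∀ A → Valid A → Der S [] [ A ]

-- A system containing Mp is complete by proof search. Mp has no weakening,
-- so a valid sequent need not be derivable, but it always has a derivable
-- sub-multiset: the literals of a valid sequent contain a complementary pair,
-- (par) and (⊕) rebuild a disjunction, and the context-sharing (∧) rebuilds a
-- conjunction from derivable sub-multisets of Γ, A and of Γ, B by letting their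
-- common part be its shared context. A derivable sub-multiset of a single
-- formula is the formula itself, as no derivable sequent is empty.
--
-- Conversely, a rule of Mp is derivable in S if it is a rule of S, or if S has
-- (⊕) and (C) for (par), (W) and (par) for (⊕), (⊗) and (C) or (&) and (W) for
-- (∧). Otherwise S lies in one of seven subsystems, and for each of them a
-- property of sequents holds of the axioms, is preserved by the rules, and
-- fails for a valid formula in two variables P and Q.

module Submission where

open import Defs
open import Data.Bool using (Bool; true; false; T; not; _∨_; _∧_; if_then_else_)
open import Data.Bool.Properties using (T-∧; T-∨; T-≡; ∨-assoc; ∨-comm; ∨-idempotentCommutativeMonoid)
open import Data.Empty using (⊥; ⊥-elim)
open import Data.Unit using (⊤)
open import Data.List using (List; []; _∷_; _++_; [_]; map; length)
open import Data.List.Membership.Propositional using (_∈_; find)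
open import Data.List.Membership.Propositional.Properties using (∈-∃++; ∈-++⁻; ∈-++⁺ʳ; ∈-map⁺)
open import Data.List.Relation.Unary.All.Properties using (All¬⇒¬Any)
open import Data.List.Properties using (++-conicalˡ; ++-assoc; ++-identityʳ; map-++; ∷ʳ-injective)
open import Data.List.Relation.Binary.Permutation.Propositional
  using (_↭_; refl; prep; swap; trans; ↭-sym; ↭-refl; ↭-reflexive)
open import Data.List.Relation.Binary.Permutation.Propositional.Properties
  using ( ↭-empty-inv; ↭-singleton-inv; ↭-length; ∈-resp-↭; map⁺; Any-resp-↭
        ; ++⁺ˡ; ++⁺ʳ; ++-comm; shift; drop-∷; ++-commutativeMonoid)
open import Data.List.Relation.Unary.All as All using (All; []; _∷_)
open import Data.List.Relation.Unary.Any as Any using (Any; here; there)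
import Data.List.Relation.Unary.Any.Properties as Any
open import Data.Nat using (ℕ; _≤_; s≤s; z≤n; _+_; _∸_; _⊓_; _≡ᵇ_)
open import Data.Nat.ListAction using (sum)
open import Data.Nat.ListAction.Properties using (sum-++; sum-↭)
open import Data.Nat.Properties
  using ( ≡⇒≡ᵇ; +-identityʳ; +-distribˡ-⊓; ⊓-glb; m≤n+m; m≤m+n; +-cancelˡ-≤; +-mono-≤; +-monoʳ-≤
        ; m≤n+m∸n; ≤-trans; module ≤-Reasoning)
open import Data.Nat.Tactic.RingSolver using (solve-∀)
open import Data.Integer using (ℤ; 0ℤ; 1ℤ) renaming (_+_ to _+ᶻ_; -_ to -ᶻ_)
import Data.Integer.Properties as ℤ
open import Data.Integer.Tactic.RingSolver using () renaming (solve-∀ to solve-∀ᶻ)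
import Data.Nat as ℕ
open import Data.Product using (∃; ∃₂; _×_; _,_; proj₁; proj₂)
open import Data.Sum using (_⊎_; inj₁; inj₂; [_,_]′)
import Data.Sum as Sum
open import Function using (_∘_; case_of_)
open import Function.Bundles using (_⇔_; mk⇔; Equivalence)
open import Relation.Binary.Definitions using (DecidableEquality)
open import Relation.Binary.PropositionalEquality using (_≡_; _≢_; refl; sym; cong; subst)
  renaming (trans to ≡-trans)
open import Relation.Nullary using (¬_; does; no)
open import Relation.Nullary.Decidable using (isYes; toWitness; toWitnessFalse; map′)
open import Algebra.Solver.CommutativeMonoid (++-commutativeMonoid {A = Formula})
  using (solve; _⊜_; _⊕_)
open import Algebra.Solver.IdempotentCommutativeMonoid ∨-idempotentCommutativeMonoid
  using () renaming (solve to ∨-solve; _⊜_ to _≡ₑ_; _⊕_ to _∨ₑ_; id to falseₑ)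

private variable
  S : System
  ρ : ℕ → Bool
  Λ : List Literal
  r : Rule
  H ps qs : List Sequent
  c Γ Δ Θ R X : Sequent
  A B : Formula

mutual
  graft : Der S ps c → All (Der S H) ps → Der S H c
  graft (leaf i)      ds = All.lookup ds i
  graft (ax x)        ds = ax x
  graft (app on i es) ds = app on i (graft* es ds)
  graft (perm p d)    ds = perm p (graft d ds)

  graft* : All (Der S ps) qs → All (Der S H) ps → All (Der S H) qs
  graft* []       ds = []
  graft* (e ∷ es) ds = graft e ds ∷ graft* es ds

rule⇒derivable : S r ≡ true → DerivableRule S r
rule⇒derivable on ps c i = app on i (All.tabulate leaf)

apply-derived : DerivableRule S r → Instance r ps c → All (Der S H) ps → Der S H c
apply-derived dr i = graft (dr _ _ i)

++-≢[] : ∀ Γ → Δ ≢ [] → Γ ++ Δ ≢ []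
++-≢[] []      ne = ne
++-≢[] (_ ∷ _) _  ()

snoc-≢[] : ∀ Γ → Γ ++ [ A ] ≢ []
snoc-≢[] Γ = ++-≢[] Γ λ ()

conclusion-≢[] : Instance r ps c → c ≢ []
conclusion-≢[] (inst-& Γ _ _)     = snoc-≢[] Γ
conclusion-≢[] (inst-⊗ Δ Σ _ _)   = ++-≢[] Δ (snoc-≢[] Σ)
conclusion-≢[] (inst-∧ Γ Δ Σ _ _) = ++-≢[] Γ (++-≢[] Δ (snoc-≢[] Σ))
conclusion-≢[] (inst-⊕₁ Γ _ _)    = snoc-≢[] Γ
conclusion-≢[] (inst-⊕₂ Γ _ _)    = snoc-≢[] Γ
conclusion-≢[] (inst-par Γ _ _)   = snoc-≢[] Γ
conclusion-≢[] (inst-W Γ _ _)     = snoc-≢[] Γ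
conclusion-≢[] (inst-C Γ _)       = snoc-≢[] Γ

absent : ∀ {a} {P : Set a} {b : Bool} → b ≡ false → b ≡ true → P
absent off on = case ≡-trans (sym on) off of λ ()

Preserves : Rule → (Sequent → Set) → Set
Preserves r I = ∀ {ps c} → Instance r ps c → All I ps → I c

record Invariant (S : System) (I : Sequent → Set) : Set where
  field
    resp-↭ : ∀ {Γ Δ} → Γ ↭ Δ → I Γ → I Δ
    axiom  : ∀ x → I (lit (pos x) ∷ lit (neg x) ∷ [])
    rule   : ∀ {r} → S r ≡ true → Preserves r I

  mutual
    holds : Der S [] Γ → I Γ
    holds (leaf ())
    holds (ax x)        = axiom x
    holds (app on i ds) = rule on i (holds* ds)
    holds (perm p d)    = resp-↭ p (holds d)

    holds* : All (Der S []) ps → All I ps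
    holds* []       = []
    holds* (d ∷ ds) = holds d ∷ holds* ds

nonempty : Invariant S (_≢ [])
nonempty = record
  { resp-↭ = λ { p ne refl → ne (↭-empty-inv p) }
  ; axiom  = λ _ ()
  ; rule   = λ _ i _ → conclusion-≢[] i
  }

module _ {φ : Formula → Set} where

  Any-W : Preserves W (Any φ)
  Any-W (inst-W Γ _ _) (h ∷ []) = Any.++⁺ˡ h

  Any-C : Preserves C (Any φ)
  Any-C (inst-C Γ _) (h ∷ []) with Any.++⁻ Γ h
  ... | inj₁ g                 = Any.++⁺ˡ g
  ... | inj₂ (here a)          = Any.++⁺ʳ Γ (here a)
  ... | inj₂ (there (here a))  = Any.++⁺ʳ Γ (here a)

infix 4 _⊨_

_⊨_ : (ℕ → Bool) → Sequent → Set
ρ ⊨ Γ = Any (T ∘ eval ρ) Γ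

Tautology : Sequent → Set
Tautology Γ = ∀ ρ → ρ ⊨ Γ

Tautology-resp-↭ : Γ ↭ Δ → Tautology Γ → Tautology Δ
Tautology-resp-↭ p v ρ = Any-resp-↭ p (v ρ)

∨-introˡ : ∀ {a b} → T a → T (a ∨ b)
∨-introˡ = Equivalence.from T-∨ ∘ inj₁

∨-introʳ : ∀ {a b} → T b → T (a ∨ b)
∨-introʳ = Equivalence.from T-∨ ∘ inj₂

∧-intro : ∀ {a b} → T a → T b → T (a ∧ b)
∧-intro a b = Equivalence.from T-∧ (a , b)

⊨-snoc⁻ : ∀ Γ → ρ ⊨ Γ ++ [ A ] → ρ ⊨ Γ ⊎ T (eval ρ A)
⊨-snoc⁻ Γ h = Sum.map₂ Any.singleton⁻ (Any.++⁻ Γ h)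

⊨-snoc⁺ : ∀ Γ → T (eval ρ A) → ρ ⊨ Γ ++ [ A ]
⊨-snoc⁺ Γ t = Any.++⁺ʳ Γ (here t)

sound : ∀ ρ → Preserves r (ρ ⊨_)
sound ρ (inst-& Γ A B) (h₁ ∷ h₂ ∷ []) with ⊨-snoc⁻ Γ h₁ | ⊨-snoc⁻ Γ h₂
... | inj₁ g | _      = Any.++⁺ˡ g
... | _      | inj₁ g = Any.++⁺ˡ g
... | inj₂ a | inj₂ b = ⊨-snoc⁺ Γ (∧-intro a b)
sound ρ (inst-⊗ Δ Σ A B) (h₁ ∷ h₂ ∷ []) with ⊨-snoc⁻ Δ h₁ | ⊨-snoc⁻ Σ h₂
... | inj₁ d | _      = Any.++⁺ˡ d
... | _      | inj₁ s = Any.++⁺ʳ Δ (Any.++⁺ˡ s)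
... | inj₂ a | inj₂ b = Any.++⁺ʳ Δ (⊨-snoc⁺ Σ (∧-intro a b))
sound ρ (inst-∧ Γ Δ Σ A B) (h₁ ∷ h₂ ∷ []) with Any.++⁻ Γ h₁ | Any.++⁻ Γ h₂
... | inj₁ g  | _      = Any.++⁺ˡ g
... | _       | inj₁ g = Any.++⁺ˡ g
... | inj₂ h₁′ | inj₂ h₂′ with ⊨-snoc⁻ Δ h₁′ | ⊨-snoc⁻ Σ h₂′
...   | inj₁ d | _      = Any.++⁺ʳ Γ (Any.++⁺ˡ d)
...   | _      | inj₁ s = Any.++⁺ʳ Γ (Any.++⁺ʳ Δ (Any.++⁺ˡ s))
...   | inj₂ a | inj₂ b = Any.++⁺ʳ Γ (Any.++⁺ʳ Δ (⊨-snoc⁺ Σ (∧-intro a b)))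
sound ρ (inst-⊕₁ Γ A B) (h ∷ []) = [ Any.++⁺ˡ , ⊨-snoc⁺ Γ ∘ ∨-introˡ ]′ (⊨-snoc⁻ Γ h)
sound ρ (inst-⊕₂ Γ A B) (h ∷ []) = [ Any.++⁺ˡ , ⊨-snoc⁺ Γ ∘ ∨-introʳ {eval ρ A} ]′ (⊨-snoc⁻ Γ h)
sound ρ (inst-par Γ A B) (h ∷ []) with Any.++⁻ Γ h
... | inj₁ g                 = Any.++⁺ˡ g
... | inj₂ (here a)          = ⊨-snoc⁺ Γ (∨-introˡ a)
... | inj₂ (there (here b))  = ⊨-snoc⁺ Γ (∨-introʳ {eval ρ A} b)
sound ρ i@(inst-W _ _ _) hs = Any-W i hs
sound ρ i@(inst-C _ _)   hs = Any-C i hs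

axiom-tautology : ∀ x → Tautology (lit (pos x) ∷ lit (neg x) ∷ [])
axiom-tautology x ρ = [ here , there ∘ here ]′ (excluded-middle (ρ x))
  where
    excluded-middle : ∀ b → T b ⊎ T (not b)
    excluded-middle true  = inj₁ _
    excluded-middle false = inj₂ _

rule-tautology : Instance r ps c → All Tautology ps → Tautology c
rule-tautology i ts ρ = sound ρ i (All.map (λ t → t ρ) ts)

Tautology-⋁⁻ : Tautology ((A ⋁ B) ∷ Γ) → Tautology (A ∷ B ∷ Γ)
Tautology-⋁⁻ v ρ with v ρ
... | here t  = [ here , there ∘ here ]′ (Equivalence.to T-∨ t)
... | there h = there (there h)

Tautology-⋀⁻ˡ : Tautology ((A ⋀ B) ∷ Γ) → Tautology (A ∷ Γ)
Tautology-⋀⁻ˡ v ρ with v ρ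
... | here t  = here (proj₁ (Equivalence.to T-∧ t))
... | there h = there h

Tautology-⋀⁻ʳ : Tautology ((A ⋀ B) ∷ Γ) → Tautology (B ∷ Γ)
Tautology-⋀⁻ʳ v ρ with v ρ
... | here t  = here (proj₂ (Equivalence.to T-∧ t))
... | there h = there h

∈⇒↭∷ : A ∈ Γ → ∃ λ Δ → Γ ↭ A ∷ Δ
∈⇒↭∷ A∈ with Γ₁ , Γ₂ , refl ← ∈-∃++ A∈ = Γ₁ ++ Γ₂ , shift _ Γ₁ Γ₂

drop-last : Γ ++ [ A ] ↭ A ∷ Δ → Γ ↭ Δ
drop-last {Γ} p = drop-∷ (trans (++-comm [ _ ] Γ) p)

↭-pair-inv : ∀ {Γ} {A B : Formula} → Γ ↭ A ∷ B ∷ [] → Γ ≡ A ∷ B ∷ [] ⊎ Γ ≡ B ∷ A ∷ []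
↭-pair-inv {[]}              p = case ↭-length p of λ ()
↭-pair-inv {_ ∷ []}          p = case ↭-length p of λ ()
↭-pair-inv {_ ∷ _ ∷ _ ∷ _}   p = case ↭-length p of λ ()
↭-pair-inv {_ ∷ _ ∷ []} {A} {B} p with ∈-resp-↭ p (here refl)
... | here refl         with refl ← ↭-singleton-inv (drop-∷ p) = inj₁ refl
... | there (here refl) with refl ← ↭-singleton-inv (drop-∷ (trans p (swap A B refl))) = inj₂ refl

infix 4 _⊑_

_⊑_ : Sequent → Sequent → Set
Δ ⊑ Γ = ∃ λ R → Δ ++ R ↭ Γ

⊑-respʳ-↭ : Γ ↭ X → Δ ⊑ Γ → Δ ⊑ X
⊑-respʳ-↭ p (R , q) = R , trans q p

⊑-respˡ-↭ : Δ ↭ Θ → Δ ⊑ Γ → Θ ⊑ Γ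
⊑-respˡ-↭ p (R , q) = R , trans (++⁺ʳ R (↭-sym p)) q

∷-⊑-∷ : Δ ⊑ Γ → A ∷ Δ ⊑ A ∷ Γ
∷-⊑-∷ (R , q) = R , prep _ q

⊑-∷ : Δ ⊑ Γ → Δ ⊑ A ∷ Γ
⊑-∷ {Δ} {A = A} (R , q) = A ∷ R , trans (shift A Δ R) (prep A q)

⊑[]⇒≡[] : Δ ⊑ [] → Δ ≡ []
⊑[]⇒≡[] {Δ} (R , q) = ++-conicalˡ Δ R (↭-empty-inv q)

⊑-∷⁻ : Δ ⊑ A ∷ Γ → (∃ λ Δ′ → Δ ↭ A ∷ Δ′ × Δ′ ⊑ Γ) ⊎ Δ ⊑ Γ
⊑-∷⁻ {Δ} {A} (R , q) with ∈-++⁻ Δ (∈-resp-↭ (↭-sym q) (here refl))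
... | inj₁ A∈Δ with Δ′ , p ← ∈⇒↭∷ A∈Δ =
  inj₁ (Δ′ , p , R , drop-∷ (trans (↭-sym (++⁺ʳ R p)) q))
... | inj₂ A∈R with R′ , p ← ∈⇒↭∷ A∈R =
  inj₂ (R′ , drop-∷ (trans (↭-sym (shift A Δ R′)) (trans (++⁺ˡ Δ (↭-sym p)) q)))

record Join (Δ₁ Δ₂ Γ : Sequent) : Set where
  constructor join
  field
    shared only₁ only₂ : Sequent
    split₁ : Δ₁ ↭ shared ++ only₁
    split₂ : Δ₂ ↭ shared ++ only₂
    union  : shared ++ only₁ ++ only₂ ⊑ Γ

⊑-join : ∀ Γ {Δ₁ Δ₂} → Δ₁ ⊑ Γ → Δ₂ ⊑ Γ → Join Δ₁ Δ₂ Γ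
⊑-join [] s₁ s₂ rewrite ⊑[]⇒≡[] s₁ | ⊑[]⇒≡[] s₂ = join [] [] [] ↭-refl ↭-refl ([] , ↭-refl)
⊑-join (A ∷ Γ) s₁ s₂ with ⊑-∷⁻ s₁ | ⊑-∷⁻ s₂
... | inj₁ (_ , p₁ , s₁′) | inj₁ (_ , p₂ , s₂′) with join Θ D E q₁ q₂ u ← ⊑-join Γ s₁′ s₂′ =
  join (A ∷ Θ) D E (trans p₁ (prep A q₁)) (trans p₂ (prep A q₂)) (∷-⊑-∷ u)
... | inj₁ (_ , p₁ , s₁′) | inj₂ s₂′ with join Θ D E q₁ q₂ u ← ⊑-join Γ s₁′ s₂′ =
  join Θ (A ∷ D) E (trans p₁ (trans (prep A q₁) (↭-sym (shift A Θ D)))) q₂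
    (⊑-respˡ-↭ (↭-sym (shift A Θ (D ++ E))) (∷-⊑-∷ u))
... | inj₂ s₁′ | inj₁ (_ , p₂ , s₂′) with join Θ D E q₁ q₂ u ← ⊑-join Γ s₁′ s₂′ =
  join Θ D (A ∷ E) q₁ (trans p₂ (trans (prep A q₂) (↭-sym (shift A Θ E))))
    (⊑-respˡ-↭ (solve 4 (λ a t d e → a ⊕ (t ⊕ (d ⊕ e)) ⊜ t ⊕ (d ⊕ (a ⊕ e))) ↭-refl [ A ] Θ D E)
               (∷-⊑-∷ u))
... | inj₂ s₁′ | inj₂ s₂′ with join Θ D E q₁ q₂ u ← ⊑-join Γ s₁′ s₂′ = join Θ D E q₁ q₂ (⊑-∷ u)

-- Systems containing Mp are complete

SubDerivable : System → Sequent → Set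
SubDerivable S Γ = ∃ λ Δ → Δ ⊑ Γ × Der S [] Δ

SubDerivable-resp-↭ : Γ ↭ X → SubDerivable S Γ → SubDerivable S X
SubDerivable-resp-↭ p (Δ , s , d) = Δ , ⊑-respʳ-↭ p s , d

SubDerivable-∷ : SubDerivable S Γ → SubDerivable S (A ∷ Γ)
SubDerivable-∷ (Δ , s , d) = Δ , ⊑-∷ s , d

principal-last : Der S [] Δ → Δ ↭ A ∷ Θ → Θ ⊑ Γ → SubDerivable S (A ∷ Γ)
principal-last d p s = _ , ⊑-respˡ-↭ (↭-sym p) (∷-⊑-∷ s) , d

_≟ₗ_ : DecidableEquality Literal
pos x ≟ₗ pos y = map′ (cong pos) (λ { refl → refl }) (x ℕ.≟ y)
pos x ≟ₗ neg y = no λ ()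
neg x ≟ₗ pos y = no λ ()
neg x ≟ₗ neg y = map′ (cong neg) (λ { refl → refl }) (x ℕ.≟ y)

open import Data.List.Membership.DecPropositional _≟ₗ_ using (_∈?_)

complementary-literals : Tautology (map lit Λ) → ∃ λ x → pos x ∈ Λ × neg x ∈ Λ
complementary-literals {Λ} v with find (Any.map⁻ (v ρΛ))
  where
    -- A literal of Λ true under ρΛ has its complement in Λ.
    ρΛ : ℕ → Bool
    ρΛ x = isYes (neg x ∈? Λ)
... | pos x , x∈ , t = x , x∈ , toWitness {a? = neg x ∈? Λ} t
... | neg x , x∈ , t = ⊥-elim (toWitnessFalse {a? = neg x ∈? Λ} t x∈)

pair-⊑ : A ∈ Γ → B ∈ Γ → A ≢ B → A ∷ B ∷ [] ⊑ Γ
pair-⊑ A∈ B∈ A≢B with Γ′ , p ← ∈⇒↭∷ A∈ with ∈-resp-↭ p B∈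
... | here B≡A = ⊥-elim (A≢B (sym B≡A))
... | there B∈′ with Γ″ , q ← ∈⇒↭∷ B∈′ = Γ″ , ↭-sym (trans p (prep _ q))

literals-sub-derivable : Tautology (map lit Λ) → SubDerivable S (map lit Λ)
literals-sub-derivable v with x , x∈ , x̄∈ ← complementary-literals v =
  _ , pair-⊑ (∈-map⁺ lit x∈) (∈-map⁺ lit x̄∈) (λ ()) , ax x

SubComplete : System → Sequent → Set
SubComplete S Γ = ∀ Λ → Tautology (Γ ++ map lit Λ) → SubDerivable S (Γ ++ map lit Λ)

module _ (mp : Contains S Mp) where

  private
    derive : Mp r ≡ true → Instance r ps c → All (Der S []) ps → Der S [] c
    derive on = apply-derived (mp _ on)

    to-end : Δ ↭ A ∷ Θ → Der S [] Δ → Der S [] (Θ ++ [ A ])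
    to-end {Θ = Θ} p = perm (trans p (++-comm [ _ ] Θ))

  ⋁-step : SubDerivable S (A ∷ B ∷ Γ) → SubDerivable S ((A ⋁ B) ∷ Γ)
  ⋁-step {A} {B} (Δ , s , d) with ⊑-∷⁻ s
  ... | inj₁ (Δ₁ , p , s₁) with ⊑-∷⁻ s₁
  ...   | inj₁ (Δ₂ , q , s₂) =
    principal-last
      (derive refl (inst-par Δ₂ A B) (perm (trans p (trans (prep A q) (++-comm (A ∷ B ∷ []) Δ₂))) d ∷ []))
      (++-comm Δ₂ _) s₂
  ...   | inj₂ s₂ = principal-last (derive refl (inst-⊕₁ Δ₁ A B) (to-end p d ∷ [])) (++-comm Δ₁ _) s₂
  ⋁-step {A} {B} (Δ , s , d) | inj₂ s₁ with ⊑-∷⁻ s₁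
  ...   | inj₁ (Δ₂ , q , s₂) =
    principal-last (derive refl (inst-⊕₂ Δ₂ A B) (to-end q d ∷ [])) (++-comm Δ₂ _) s₂
  ...   | inj₂ s₂ = SubDerivable-∷ (Δ , s₂ , d)

  ⋀-step : SubDerivable S (A ∷ Γ) → SubDerivable S (B ∷ Γ) → SubDerivable S ((A ⋀ B) ∷ Γ)
  ⋀-step {A} {Γ} {B} (Δ₁ , s₁ , d₁) (Δ₂ , s₂ , d₂) with ⊑-∷⁻ s₁ | ⊑-∷⁻ s₂
  ... | inj₂ s₁′ | _       = SubDerivable-∷ (Δ₁ , s₁′ , d₁)
  ... | _        | inj₂ s₂′ = SubDerivable-∷ (Δ₂ , s₂′ , d₂)
  ... | inj₁ (_ , p₁ , s₁′) | inj₁ (_ , p₂ , s₂′) with join Θ D E q₁ q₂ u ← ⊑-join Γ s₁′ s₂′ =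
    principal-last
      (derive refl (inst-∧ Θ D E A B) (perm (trans p₁ (trans (prep A q₁) (to-end′ A Θ D))) d₁
                                       ∷ perm (trans p₂ (trans (prep B q₂) (to-end′ B Θ E))) d₂ ∷ []))
      (solve 4 (λ t d e x → t ⊕ (d ⊕ (e ⊕ x)) ⊜ x ⊕ (t ⊕ (d ⊕ e))) ↭-refl Θ D E [ A ⋀ B ])
      u
    where
      to-end′ : ∀ F Θ D → F ∷ Θ ++ D ↭ Θ ++ D ++ [ F ]
      to-end′ F Θ D = solve 3 (λ f t d → f ⊕ (t ⊕ d) ⊜ t ⊕ (d ⊕ f)) ↭-refl [ F ] Θ D

  decompose : ∀ A → SubComplete S Γ → SubComplete S (A ∷ Γ)
  decompose {Γ = Γ} (lit l) h Λ v =
    SubDerivable-resp-↭ (shift (lit l) Γ (map lit Λ))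
      (h (l ∷ Λ) (Tautology-resp-↭ (↭-sym (shift (lit l) Γ (map lit Λ))) v))
  decompose (A ⋁ B) h Λ v = ⋁-step (decompose A (decompose B h) Λ (Tautology-⋁⁻ v))
  decompose (A ⋀ B) h Λ v = ⋀-step (decompose A h Λ (Tautology-⋀⁻ˡ v)) (decompose B h Λ (Tautology-⋀⁻ʳ v))

  sub-complete : ∀ Γ → SubComplete S Γ
  sub-complete []      _ = literals-sub-derivable
  sub-complete (A ∷ Γ)   = decompose A (sub-complete Γ)

  contains-Mp⇒complete : Complete S
  contains-Mp⇒complete F v with Δ , s , d ← sub-complete [ F ] [] (λ ρ → here (Equivalence.from T-≡ (v ρ)))
                              with ⊑-∷⁻ s
  ... | inj₁ (Δ′ , p , s′) rewrite ⊑[]⇒≡[] s′ = perm p d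
  ... | inj₂ s′ = ⊥-elim (Invariant.holds nonempty d (⊑[]⇒≡[] s′))

-- Derived rules

private
  premise₁ : Der S (Γ ∷ H) Γ
  premise₁ = leaf (here refl)

  premise₂ : Der S (Δ ∷ Γ ∷ H) Γ
  premise₂ = leaf (there (here refl))

contract : S C ≡ true → Der S H (A ∷ A ∷ Θ) → Der S H (A ∷ Θ)
contract {A = A} {Θ} on d =
  perm (++-comm Θ [ A ]) (app on (inst-C Θ A) (perm (++-comm (A ∷ A ∷ []) Θ) d ∷ []))

contract* : S C ≡ true → ∀ Γ → Der S H (Γ ++ Γ ++ R) → Der S H (Γ ++ R)
contract*         on []      d = d
contract* {R = R} on (A ∷ Γ) d =
  contract on (perm (solve 3 (λ g a r → g ⊕ (a ⊕ (a ⊕ r)) ⊜ a ⊕ (a ⊕ (g ⊕ r))) ↭-refl Γ [ A ] R)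
    (contract* on Γ (perm (solve 3 (λ a g r → a ⊕ (g ⊕ (a ⊕ (g ⊕ r))) ⊜ g ⊕ (g ⊕ (a ⊕ (a ⊕ r))))
                                  ↭-refl [ A ] Γ R) d)))

weaken* : S W ≡ true → Δ ≢ [] → Der S H Δ → Der S H (Δ ++ X)
weaken* {Δ = Δ} {X = []}    on ne d = perm (↭-reflexive (sym (++-identityʳ Δ))) d
weaken* {Δ = Δ} {X = A ∷ X} on ne d =
  perm (↭-reflexive (++-assoc Δ [ A ] X))
    (weaken* on (snoc-≢[] Δ) (app on (inst-W Δ A ne) (d ∷ [])))

⊕+C⇒par : S ⊕r ≡ true → S C ≡ true → DerivableRule S par
⊕+C⇒par on⊕ onC _ _ (inst-par Γ A B) =
  app onC (inst-C Γ (A ⋁ B))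
    (perm (↭-reflexive (++-assoc Γ _ _))
      (app on⊕ (inst-⊕₂ (Γ ++ [ A ⋁ B ]) A B)
        (perm (swap-last B (A ⋁ B))
          (app on⊕ (inst-⊕₁ (Γ ++ [ B ]) A B)
            (perm (trans (↭-reflexive (sym (++-assoc Γ [ A ] [ B ]))) (swap-last A B)) premise₁ ∷ []))
        ∷ []))
    ∷ [])
  where
    swap-last : ∀ F G → (Γ ++ [ F ]) ++ [ G ] ↭ (Γ ++ [ G ]) ++ [ F ]
    swap-last F G = solve 3 (λ g f h → (g ⊕ f) ⊕ h ⊜ (g ⊕ h) ⊕ f) ↭-refl Γ [ F ] [ G ]

W+par⇒⊕ : S W ≡ true → S par ≡ true → DerivableRule S ⊕r
W+par⇒⊕ onW onPar _ _ (inst-⊕₁ Γ A₁ A₂) =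
  app onPar (inst-par Γ A₁ A₂)
    (perm (↭-reflexive (++-assoc Γ [ A₁ ] [ A₂ ]))
      (app onW (inst-W (Γ ++ [ A₁ ]) A₂ (snoc-≢[] Γ)) (premise₁ ∷ [])) ∷ [])
W+par⇒⊕ onW onPar _ _ (inst-⊕₂ Γ A₁ A₂) =
  app onPar (inst-par Γ A₁ A₂)
    (perm (solve 3 (λ g a₂ a₁ → (g ⊕ a₂) ⊕ a₁ ⊜ g ⊕ (a₁ ⊕ a₂)) ↭-refl Γ [ A₂ ] [ A₁ ])
      (app onW (inst-W (Γ ++ [ A₂ ]) A₁ (snoc-≢[] Γ)) (premise₁ ∷ [])) ∷ [])

⊗+C⇒∧ : S ⊗r ≡ true → S C ≡ true → DerivableRule S ∧r
⊗+C⇒∧ {S = S} on⊗ onC _ _ (inst-∧ Γ Δ Σ A B) =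
  contract* onC Γ
    (perm (solve 4 (λ g d s x → (g ⊕ d) ⊕ ((g ⊕ s) ⊕ x) ⊜ g ⊕ (g ⊕ (d ⊕ (s ⊕ x)))) ↭-refl Γ Δ Σ [ A ⋀ B ])
      (app on⊗ (inst-⊗ (Γ ++ Δ) (Γ ++ Σ) A B) (reassoc premise₁ ∷ reassoc premise₂ ∷ [])))
  where
    reassoc : ∀ {H Θ F} → Der S H (Γ ++ Θ ++ [ F ]) → Der S H ((Γ ++ Θ) ++ [ F ])
    reassoc {Θ = Θ} = subst (Der S _) (sym (++-assoc Γ Θ _))

&+W⇒∧ : S &r ≡ true → S W ≡ true → DerivableRule S ∧r
&+W⇒∧ on& onW _ _ (inst-∧ Γ Δ Σ A B) =
  perm (solve 4 (λ g d s x → (g ⊕ (d ⊕ s)) ⊕ x ⊜ g ⊕ (d ⊕ (s ⊕ x))) ↭-refl Γ Δ Σ [ A ⋀ B ])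
    (app on& (inst-& (Γ ++ Δ ++ Σ) A B)
      ( perm (solve 4 (λ g d s a → (g ⊕ (d ⊕ a)) ⊕ s ⊜ (g ⊕ (d ⊕ s)) ⊕ a) ↭-refl Γ Δ Σ [ A ])
          (weaken* onW (++-≢[] Γ (snoc-≢[] Δ)) premise₁)
      ∷ perm (solve 4 (λ g d s b → (g ⊕ (s ⊕ b)) ⊕ d ⊜ (g ⊕ (d ⊕ s)) ⊕ b) ↭-refl Γ Δ Σ [ B ])
          (weaken* onW (++-≢[] Γ (snoc-≢[] Σ)) premise₂)
      ∷ []))

-- Invariants of subsystems

P P̄ Q Q̄ : Formula
P = lit (pos 0)
P̄ = lit (neg 0)
Q = lit (pos 1)
Q̄ = lit (neg 1)

Q′ : Formula
Q′ = (P ⋀ Q) ⋁ (P̄ ⋀ Q)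

length≥2 : S par ≡ false → S C ≡ false → Invariant S (λ Γ → 2 ≤ length Γ)
length≥2 {S} no-par no-C = record
  { resp-↭ = λ p → subst (2 ≤_) (↭-length p)
  ; axiom  = λ _ → s≤s (s≤s z≤n)
  ; rule   = rule
  }
  where
    two : Γ ≢ [] → 2 ≤ ℕ.suc (length Γ)
    two {Γ = []}    ne = ⊥-elim (ne refl)
    two {Γ = _ ∷ _} _  = s≤s (s≤s z≤n)

    rule : S r ≡ true → Preserves r (λ Γ → 2 ≤ length Γ)
    rule {par} on = absent no-par on
    rule {C}   on = absent no-C on
    rule _ (inst-& []      _ _)         (s≤s () ∷ _)
    rule _ (inst-& (_ ∷ Γ) _ _)         _ = two (snoc-≢[] Γ)
    rule _ (inst-⊗ []      _ _ _)       (s≤s () ∷ _)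
    rule _ (inst-⊗ (_ ∷ Δ) Σ _ _)       _ = two (++-≢[] Δ (snoc-≢[] Σ))
    rule _ (inst-∧ [] []   _ _ _)       (s≤s () ∷ _)
    rule _ (inst-∧ [] (_ ∷ Δ) Σ _ _)    _ = two (++-≢[] Δ (snoc-≢[] Σ))
    rule _ (inst-∧ (_ ∷ Γ) Δ Σ _ _)     _ = two (++-≢[] Γ (++-≢[] Δ (snoc-≢[] Σ)))
    rule _ (inst-⊕₁ []      _ _)        (s≤s () ∷ _)
    rule _ (inst-⊕₁ (_ ∷ Γ) _ _)        _ = two (snoc-≢[] Γ)
    rule _ (inst-⊕₂ []      _ _)        (s≤s () ∷ _)
    rule _ (inst-⊕₂ (_ ∷ Γ) _ _)        _ = two (snoc-≢[] Γ)
    rule _ (inst-W []      _ ne)        _ = ⊥-elim (ne refl)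
    rule _ (inst-W (_ ∷ Γ) _ _)         _ = two (snoc-≢[] Γ)

IsDisjunction IsConjunction : Formula → Set
IsDisjunction (_ ⋁ _) = ⊤
IsDisjunction _       = ⊥
IsConjunction (_ ⋀ _) = ⊤
IsConjunction _       = ⊥

some-non-⋁ : S par ≡ false → S ⊕r ≡ false → Invariant S (Any (¬_ ∘ IsDisjunction))
some-non-⋁ {S} no-par no-⊕ = record
  { resp-↭ = Any-resp-↭
  ; axiom  = λ _ → here λ ()
  ; rule   = rule
  }
  where
    rule : S r ≡ true → Preserves r (Any (¬_ ∘ IsDisjunction))
    rule {par} on = absent no-par on
    rule {⊕r}  on = absent no-⊕ on
    rule {W}   _  = Any-W
    rule {C}   _  = Any-C
    rule _ (inst-& Γ _ _)     _ = Any.++⁺ʳ Γ (here λ ())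
    rule _ (inst-⊗ Δ Σ _ _)   _ = Any.++⁺ʳ Δ (Any.++⁺ʳ Σ (here λ ()))
    rule _ (inst-∧ Γ Δ Σ _ _) _ = Any.++⁺ʳ Γ (Any.++⁺ʳ Δ (Any.++⁺ʳ Σ (here λ ())))

some-non-⋀ : S ∧r ≡ false → S ⊗r ≡ false → S &r ≡ false → Invariant S (Any (¬_ ∘ IsConjunction))
some-non-⋀ {S} no-∧ no-⊗ no-& = record
  { resp-↭ = Any-resp-↭
  ; axiom  = λ _ → here λ ()
  ; rule   = rule
  }
  where
    rule : S r ≡ true → Preserves r (Any (¬_ ∘ IsConjunction))
    rule {∧r} on = absent no-∧ on
    rule {⊗r} on = absent no-⊗ on
    rule {&r} on = absent no-& on
    rule {W}  _  = Any-W
    rule {C}  _  = Any-C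
    rule _ (inst-⊕₁ Γ _ _)  _ = Any.++⁺ʳ Γ (here λ ())
    rule _ (inst-⊕₂ Γ _ _)  _ = Any.++⁺ʳ Γ (here λ ())
    rule _ (inst-par Γ _ _) _ = Any.++⁺ʳ Γ (here λ ())

occursᶠ : Literal → Formula → Bool
occursᶠ l (lit l′) = does (l ≟ₗ l′)
occursᶠ l (A ⋀ B)  = occursᶠ l A ∨ occursᶠ l B
occursᶠ l (A ⋁ B)  = occursᶠ l A ∨ occursᶠ l B

occurs : Literal → Sequent → Bool
occurs l []      = false
occurs l (A ∷ Γ) = occursᶠ l A ∨ occurs l Γ

occurs-++ : ∀ l Γ {Δ} → occurs l (Γ ++ Δ) ≡ occurs l Γ ∨ occurs l Δ
occurs-++ l []      = refl
occurs-++ l (A ∷ Γ) = ≡-trans (cong (occursᶠ l A ∨_) (occurs-++ l Γ)) (sym (∨-assoc (occursᶠ l A) _ _))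

occurs-↭ : ∀ l → Γ ↭ Δ → occurs l Γ ≡ occurs l Δ
occurs-↭ l refl         = refl
occurs-↭ l (prep A p)   = cong (occursᶠ l A ∨_) (occurs-↭ l p)
occurs-↭ l (swap A B p) = ≡-trans (cong (λ b → occursᶠ l A ∨ (occursᶠ l B ∨ b)) (occurs-↭ l p))
    (∨-solve 3 (λ a b g → a ∨ₑ (b ∨ₑ g) ≡ₑ b ∨ₑ (a ∨ₑ g)) refl (occursᶠ l A) (occursᶠ l B) _)
occurs-↭ l (trans p q)  = ≡-trans (occurs-↭ l p) (occurs-↭ l q)

record Paired (Γ : Sequent) : Set where
  constructor paired
  field
    neg-occurs : ∀ x → T (occurs (pos x) Γ) → T (occurs (neg x) Γ)

paired₁ : (∀ l → occurs l c ≡ occurs l Γ) → Paired Γ → Paired c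
paired₁ eq (paired h) = paired λ x → subst T (sym (eq (neg x))) ∘ h x ∘ subst T (eq (pos x))

paired₂ : (∀ l → occurs l c ≡ occurs l Γ ∨ occurs l Δ) → Paired Γ → Paired Δ → Paired c
paired₂ eq (paired h₁) (paired h₂) = paired λ x →
  subst T (sym (eq (neg x))) ∘ Equivalence.from T-∨ ∘ Sum.map (h₁ x) (h₂ x)
    ∘ Equivalence.to T-∨ ∘ subst T (eq (pos x))

module _ (l : Literal) where

  private
    o : Sequent → Bool
    o = occurs l

    oᶠ : Formula → Bool
    oᶠ = occursᶠ l

  occurs-& : ∀ Γ A B → o (Γ ++ [ A ⋀ B ]) ≡ o (Γ ++ [ A ]) ∨ o (Γ ++ [ B ])
  occurs-& Γ A B rewrite occurs-++ l Γ {[ A ⋀ B ]} | occurs-++ l Γ {[ A ]} | occurs-++ l Γ {[ B ]} =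
    ∨-solve 3 (λ g a b → g ∨ₑ ((a ∨ₑ b) ∨ₑ falseₑ) ≡ₑ (g ∨ₑ (a ∨ₑ falseₑ)) ∨ₑ (g ∨ₑ (b ∨ₑ falseₑ)))
      refl (o Γ) (oᶠ A) (oᶠ B)

  occurs-⊗ : ∀ Δ Σ A B → o (Δ ++ Σ ++ [ A ⋀ B ]) ≡ o (Δ ++ [ A ]) ∨ o (Σ ++ [ B ])
  occurs-⊗ Δ Σ A B
    rewrite occurs-++ l Δ {Σ ++ [ A ⋀ B ]} | occurs-++ l Σ {[ A ⋀ B ]}
          | occurs-++ l Δ {[ A ]} | occurs-++ l Σ {[ B ]} =
    ∨-solve 4 (λ d s a b → d ∨ₑ (s ∨ₑ ((a ∨ₑ b) ∨ₑ falseₑ)) ≡ₑ (d ∨ₑ (a ∨ₑ falseₑ)) ∨ₑ (s ∨ₑ (b ∨ₑ falseₑ)))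
      refl (o Δ) (o Σ) (oᶠ A) (oᶠ B)

  occurs-∧ : ∀ Γ Δ Σ A B → o (Γ ++ Δ ++ Σ ++ [ A ⋀ B ]) ≡ o (Γ ++ Δ ++ [ A ]) ∨ o (Γ ++ Σ ++ [ B ])
  occurs-∧ Γ Δ Σ A B
    rewrite occurs-++ l Γ {Δ ++ Σ ++ [ A ⋀ B ]} | occurs-++ l Δ {Σ ++ [ A ⋀ B ]} | occurs-++ l Σ {[ A ⋀ B ]}
          | occurs-++ l Γ {Δ ++ [ A ]} | occurs-++ l Δ {[ A ]}
          | occurs-++ l Γ {Σ ++ [ B ]} | occurs-++ l Σ {[ B ]} =
    ∨-solve 5 (λ g d s a b → g ∨ₑ (d ∨ₑ (s ∨ₑ ((a ∨ₑ b) ∨ₑ falseₑ)))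
                          ≡ₑ (g ∨ₑ (d ∨ₑ (a ∨ₑ falseₑ))) ∨ₑ (g ∨ₑ (s ∨ₑ (b ∨ₑ falseₑ))))
      refl (o Γ) (o Δ) (o Σ) (oᶠ A) (oᶠ B)

  occurs-par : ∀ Γ A B → o (Γ ++ [ A ⋁ B ]) ≡ o (Γ ++ A ∷ B ∷ [])
  occurs-par Γ A B rewrite occurs-++ l Γ {[ A ⋁ B ]} | occurs-++ l Γ {A ∷ B ∷ []} =
    ∨-solve 3 (λ g a b → g ∨ₑ ((a ∨ₑ b) ∨ₑ falseₑ) ≡ₑ g ∨ₑ (a ∨ₑ (b ∨ₑ falseₑ))) refl (o Γ) (oᶠ A) (oᶠ B)

  occurs-C : ∀ Γ A → o (Γ ++ [ A ]) ≡ o (Γ ++ A ∷ A ∷ [])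
  occurs-C Γ A rewrite occurs-++ l Γ {[ A ]} | occurs-++ l Γ {A ∷ A ∷ []} =
    ∨-solve 2 (λ g a → g ∨ₑ (a ∨ₑ falseₑ) ≡ₑ g ∨ₑ (a ∨ₑ (a ∨ₑ falseₑ))) refl (o Γ) (oᶠ A)

-- Apart from (⊕) and (W), the literals occurring in a conclusion are exactly
-- those occurring in its premises.
occurrences-paired : S ⊕r ≡ false → S W ≡ false → Invariant S Paired
occurrences-paired {S} no-⊕ no-W = record
  { resp-↭ = λ p → paired₁ (λ l → sym (occurs-↭ l p))
  ; axiom  = λ _ → paired λ _ t → t
  ; rule   = rule
  }
  where
    rule : S r ≡ true → Preserves r Paired
    rule {⊕r} on = absent no-⊕ on
    rule {W}  on = absent no-W on
    rule _ (inst-& Γ A B)     (h₁ ∷ h₂ ∷ []) = paired₂ (λ l → occurs-& l Γ A B) h₁ h₂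
    rule _ (inst-⊗ Δ Σ A B)   (h₁ ∷ h₂ ∷ []) = paired₂ (λ l → occurs-⊗ l Δ Σ A B) h₁ h₂
    rule _ (inst-∧ Γ Δ Σ A B) (h₁ ∷ h₂ ∷ []) = paired₂ (λ l → occurs-∧ l Γ Δ Σ A B) h₁ h₂
    rule _ (inst-par Γ A B)   (h ∷ [])       = paired₁ (λ l → occurs-par l Γ A B) h
    rule _ (inst-C Γ A)       (h ∷ [])       = paired₁ (λ l → occurs-C l Γ A) h

-- Twice the value in three-valued Łukasiewicz logic when every literal has
-- value ½, reading ⋀ and ⋁ as strong conjunction max(0, a + b − 1) and strong
-- disjunction min(1, a + b). A sequent is then true when 2 ≤ łₛ Γ, which all
-- rules but (∧), (&) and (C) preserve.
ł : Formula → ℕ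
ł (lit _) = 1
ł (A ⋀ B) = ł A + ł B ∸ 2
ł (A ⋁ B) = 2 ⊓ (ł A + ł B)

łₛ : Sequent → ℕ
łₛ Γ = sum (map ł Γ)

łₛ-++ : ∀ Γ Δ → łₛ (Γ ++ Δ) ≡ łₛ Γ + łₛ Δ
łₛ-++ Γ Δ = ≡-trans (cong sum (map-++ ł Γ Δ)) (sum-++ (map ł Γ) (map ł Δ))

łₛ-snoc : ∀ Γ A → łₛ (Γ ++ [ A ]) ≡ łₛ Γ + ł A
łₛ-snoc Γ A = ≡-trans (łₛ-++ Γ [ A ]) (cong (łₛ Γ +_) (+-identityʳ (ł A)))

⊕-bound : ∀ g a → 2 ≤ g + a → 2 ≤ g + 2 ⊓ a
⊕-bound g a h = subst (2 ≤_) (sym (+-distribˡ-⊓ g 2 a)) (⊓-glb (m≤n+m 2 g) h)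

⊗-bound : ∀ d s a b → 2 ≤ d + a → 2 ≤ s + b → 2 ≤ d + (s + (a + b ∸ 2))
⊗-bound d s a b h₁ h₂ = +-cancelˡ-≤ 2 _ _ (begin
  2 + 2                       ≤⟨ +-mono-≤ h₁ h₂ ⟩
  (d + a) + (s + b)           ≡⟨ medial d a s b ⟩
  (d + s) + (a + b)           ≤⟨ +-monoʳ-≤ (d + s) (m≤n+m∸n (a + b) 2) ⟩
  (d + s) + (2 + (a + b ∸ 2)) ≡⟨ shuffle d s (a + b ∸ 2) ⟩
  2 + (d + (s + (a + b ∸ 2))) ∎)
  where
    open ≤-Reasoning
    medial : ∀ d a s b → (d + a) + (s + b) ≡ (d + s) + (a + b)
    medial = solve-∀
    shuffle : ∀ d s t → (d + s) + (2 + t) ≡ 2 + (d + (s + t))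
    shuffle = solve-∀

łukasiewicz : S ∧r ≡ false → S &r ≡ false → S C ≡ false → Invariant S (λ Γ → 2 ≤ łₛ Γ)
łukasiewicz {S} no-∧ no-& no-C = record
  { resp-↭ = λ p → subst (2 ≤_) (sum-↭ (map⁺ ł p))
  ; axiom  = λ _ → s≤s (s≤s z≤n)
  ; rule   = rule
  }
  where
    from-snoc : ∀ Γ A → 2 ≤ łₛ (Γ ++ [ A ]) → 2 ≤ łₛ Γ + ł A
    from-snoc Γ A = subst (2 ≤_) (łₛ-snoc Γ A)

    to-snoc : ∀ Γ A → 2 ≤ łₛ Γ + ł A → 2 ≤ łₛ (Γ ++ [ A ])
    to-snoc Γ A = subst (2 ≤_) (sym (łₛ-snoc Γ A))

    rule : S r ≡ true → Preserves r (λ Γ → 2 ≤ łₛ Γ)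
    rule {∧r} on = absent no-∧ on
    rule {&r} on = absent no-& on
    rule {C}  on = absent no-C on
    rule _ (inst-⊗ Δ Σ A B) (h₁ ∷ h₂ ∷ []) =
      subst (2 ≤_) (sym (≡-trans (łₛ-++ Δ _) (cong (łₛ Δ +_) (łₛ-snoc Σ (A ⋀ B)))))
        (⊗-bound (łₛ Δ) (łₛ Σ) (ł A) (ł B) (from-snoc Δ A h₁) (from-snoc Σ B h₂))
    rule _ (inst-⊕₁ Γ A B) (h ∷ []) =
      to-snoc Γ (A ⋁ B) (⊕-bound (łₛ Γ) _ (≤-trans (from-snoc Γ A h) (+-monoʳ-≤ (łₛ Γ) (m≤m+n (ł A) (ł B)))))
    rule _ (inst-⊕₂ Γ A B) (h ∷ []) =
      to-snoc Γ (A ⋁ B) (⊕-bound (łₛ Γ) _ (≤-trans (from-snoc Γ B h) (+-monoʳ-≤ (łₛ Γ) (m≤n+m (ł B) (ł A)))))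
    rule _ (inst-par Γ A B) (h ∷ []) =
      to-snoc Γ (A ⋁ B) (⊕-bound (łₛ Γ) _
        (subst (2 ≤_) (≡-trans (łₛ-++ Γ (A ∷ B ∷ [])) (cong (λ b → łₛ Γ + (ł A + b)) (+-identityʳ (ł B)))) h))
    rule _ (inst-W Γ A _) (h ∷ []) = to-snoc Γ A (≤-trans h (m≤m+n (łₛ Γ) (ł A)))

complementaryₗ : Literal → Literal → Bool
complementaryₗ (pos x) (neg y) = x ≡ᵇ y
complementaryₗ (neg x) (pos y) = x ≡ᵇ y
complementaryₗ _       _       = false

complementary : Formula → Formula → Bool
complementary (lit l) (lit l′) = complementaryₗ l l′
complementary _       _        = false

-- Without (⊗), (W) and (∧) no rule lengthens a sequent, so derivable sequents
-- have one or two formulas. provable₁ A and provable₂ A B over-approximate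
-- derivability of A and of A, B: each disjunct is a rule that can end such a
-- derivation.
mutual
  provable₂ : Formula → Formula → Bool
  provable₂ A B = complementary A B ∨ (unfoldˡ A B ∨ unfoldʳ A B)

  unfoldˡ : Formula → Formula → Bool
  unfoldˡ (lit _)   B = false
  unfoldˡ (A₁ ⋀ A₂) B = provable₂ A₁ B ∧ provable₂ A₂ B
  unfoldˡ (A₁ ⋁ A₂) B = provable₂ A₁ B ∨ provable₂ A₂ B

  unfoldʳ : Formula → Formula → Bool
  unfoldʳ A (lit _)   = false
  unfoldʳ A (B₁ ⋀ B₂) = provable₂ A B₁ ∧ provable₂ A B₂
  unfoldʳ A (B₁ ⋁ B₂) = provable₂ A B₁ ∨ provable₂ A B₂

mutual
  provable₁ : Formula → Bool
  provable₁ A = provable₂ A A ∨ unfold₁ A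

  unfold₁ : Formula → Bool
  unfold₁ (lit _)   = false
  unfold₁ (A₁ ⋀ A₂) = provable₁ A₁ ∧ provable₁ A₂
  unfold₁ (A₁ ⋁ A₂) = provable₂ A₁ A₂ ∨ (provable₁ A₁ ∨ provable₁ A₂)

≡ᵇ-sym : ∀ x y → (x ≡ᵇ y) ≡ (y ≡ᵇ x)
≡ᵇ-sym ℕ.zero    ℕ.zero    = refl
≡ᵇ-sym ℕ.zero    (ℕ.suc y) = refl
≡ᵇ-sym (ℕ.suc x) ℕ.zero    = refl
≡ᵇ-sym (ℕ.suc x) (ℕ.suc y) = ≡ᵇ-sym x y

complementaryₗ-sym : ∀ l l′ → complementaryₗ l l′ ≡ complementaryₗ l′ l
complementaryₗ-sym (pos x) (neg y) = ≡ᵇ-sym x y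
complementaryₗ-sym (neg x) (pos y) = ≡ᵇ-sym x y
complementaryₗ-sym (pos _) (pos _) = refl
complementaryₗ-sym (neg _) (neg _) = refl

complementary-sym : ∀ A B → complementary A B ≡ complementary B A
complementary-sym (lit l) (lit l′) = complementaryₗ-sym l l′
complementary-sym (lit _) (_ ⋀ _)  = refl
complementary-sym (lit _) (_ ⋁ _)  = refl
complementary-sym (_ ⋀ _) (lit _)  = refl
complementary-sym (_ ⋀ _) (_ ⋀ _)  = refl
complementary-sym (_ ⋀ _) (_ ⋁ _)  = refl
complementary-sym (_ ⋁ _) (lit _)  = refl
complementary-sym (_ ⋁ _) (_ ⋀ _)  = refl
complementary-sym (_ ⋁ _) (_ ⋁ _)  = refl

mutual
  provable₂-sym : ∀ A B → provable₂ A B ≡ provable₂ B A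
  provable₂-sym A B rewrite complementary-sym A B | unfoldˡ-sym A B | unfoldʳ-sym A B =
    cong (complementary B A ∨_) (∨-comm (unfoldʳ B A) (unfoldˡ B A))

  unfoldˡ-sym : ∀ A B → unfoldˡ A B ≡ unfoldʳ B A
  unfoldˡ-sym (lit _)   B = refl
  unfoldˡ-sym (A₁ ⋀ A₂) B rewrite provable₂-sym A₁ B | provable₂-sym A₂ B = refl
  unfoldˡ-sym (A₁ ⋁ A₂) B rewrite provable₂-sym A₁ B | provable₂-sym A₂ B = refl

  unfoldʳ-sym : ∀ A B → unfoldʳ A B ≡ unfoldˡ B A
  unfoldʳ-sym A (lit _)   = refl
  unfoldʳ-sym A (B₁ ⋀ B₂) rewrite provable₂-sym A B₁ | provable₂-sym A B₂ = refl
  unfoldʳ-sym A (B₁ ⋁ B₂) rewrite provable₂-sym A B₁ | provable₂-sym A B₂ = refl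

Accepted : Sequent → Set
Accepted Γ = (∃ λ A → Γ ↭ [ A ] × T (provable₁ A))
           ⊎ (∃₂ λ A B → Γ ↭ A ∷ B ∷ [] × T (provable₂ A B))

accepted-snoc : ∀ Γ {X : Formula} → Accepted (Γ ++ [ X ]) →
                (Γ ≡ [] × T (provable₁ X)) ⊎ (∃ λ G → Γ ≡ [ G ] × T (provable₂ G X))
accepted-snoc Γ (inj₁ (A , p , t)) with refl , refl ← ∷ʳ-injective Γ [] (↭-singleton-inv p) = inj₁ (refl , t)
accepted-snoc Γ (inj₂ (A , B , p , t)) with ↭-pair-inv p
... | inj₁ eq with refl , refl ← ∷ʳ-injective Γ [ A ] eq = inj₂ (A , refl , t)
... | inj₂ eq with refl , refl ← ∷ʳ-injective Γ [ B ] eq = inj₂ (B , refl , subst T (provable₂-sym A B) t)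

accepted-pair : ∀ Γ → Accepted (Γ ++ A ∷ B ∷ []) → Γ ≡ [] × T (provable₂ A B)
accepted-pair {A} {B} Γ h with accepted-snoc (Γ ++ [ A ]) (subst Accepted (sym (++-assoc Γ [ A ] [ B ])) h)
... | inj₁ (eq , _) = ⊥-elim (snoc-≢[] Γ eq)
... | inj₂ (_ , eq , t) with refl , refl ← ∷ʳ-injective Γ [] eq = refl , t

provable₁-⋀ : ∀ A B → T (provable₁ A) → T (provable₁ B) → T (provable₁ (A ⋀ B))
provable₁-⋀ A B a b = ∨-introʳ {provable₂ (A ⋀ B) (A ⋀ B)} (∧-intro a b)

provable₁-⊕₁ : ∀ A B → T (provable₁ A) → T (provable₁ (A ⋁ B))
provable₁-⊕₁ A B a = ∨-introʳ {provable₂ (A ⋁ B) (A ⋁ B)} (∨-introʳ {provable₂ A B} (∨-introˡ a))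

provable₁-⊕₂ : ∀ A B → T (provable₁ B) → T (provable₁ (A ⋁ B))
provable₁-⊕₂ A B b =
  ∨-introʳ {provable₂ (A ⋁ B) (A ⋁ B)} (∨-introʳ {provable₂ A B} (∨-introʳ {provable₁ A} b))

provable₁-par : ∀ A B → T (provable₂ A B) → T (provable₁ (A ⋁ B))
provable₁-par A B t = ∨-introʳ {provable₂ (A ⋁ B) (A ⋁ B)} (∨-introˡ t)

provable₁-C : ∀ A → T (provable₂ A A) → T (provable₁ A)
provable₁-C _ = ∨-introˡ

provable₂-unfoldʳ : ∀ G {A} → T (unfoldʳ G A) → T (provable₂ G A)
provable₂-unfoldʳ G {A} = ∨-introʳ {complementary G A} ∘ ∨-introʳ {unfoldˡ G A}

provable₂-⋀ : ∀ G A B → T (provable₂ G A) → T (provable₂ G B) → T (provable₂ G (A ⋀ B))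
provable₂-⋀ G A B a b = provable₂-unfoldʳ G (∧-intro a b)

provable₂-⊕₁ : ∀ G A B → T (provable₂ G A) → T (provable₂ G (A ⋁ B))
provable₂-⊕₁ G A B a = provable₂-unfoldʳ G (∨-introˡ a)

provable₂-⊕₂ : ∀ G A B → T (provable₂ G B) → T (provable₂ G (A ⋁ B))
provable₂-⊕₂ G A B b = provable₂-unfoldʳ G (∨-introʳ {provable₂ G A} b)

short-accepted : S ⊗r ≡ false → S W ≡ false → S ∧r ≡ false → Invariant S Accepted
short-accepted {S} no-⊗ no-W no-∧ = record
  { resp-↭ = λ p → Sum.map (λ (A , q , t) → A , trans (↭-sym p) q , t)
                           (λ (A , B , q , t) → A , B , trans (↭-sym p) q , t)
  ; axiom  = λ x → pair (∨-introˡ (≡⇒≡ᵇ x x refl))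
  ; rule   = rule
  }
  where
    single : T (provable₁ A) → Accepted [ A ]
    single t = inj₁ (_ , ↭-refl , t)

    pair : T (provable₂ A B) → Accepted (A ∷ B ∷ [])
    pair t = inj₂ (_ , _ , ↭-refl , t)

    rule : S r ≡ true → Preserves r Accepted
    rule {⊗r} on = absent no-⊗ on
    rule {W}  on = absent no-W on
    rule {∧r} on = absent no-∧ on
    rule _ (inst-& Γ A B) (h₁ ∷ h₂ ∷ []) with accepted-snoc Γ h₁ | accepted-snoc Γ h₂
    ... | inj₁ (refl , a)     | inj₁ (_ , b)        = single (provable₁-⋀ A B a b)
    ... | inj₂ (G , refl , a) | inj₂ (_ , refl , b) = pair (provable₂-⋀ G A B a b)
    ... | inj₁ (refl , _)     | inj₂ (_ , () , _)
    ... | inj₂ (_ , refl , _) | inj₁ (() , _)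
    rule _ (inst-⊕₁ Γ A B) (h ∷ []) with accepted-snoc Γ h
    ... | inj₁ (refl , a)     = single (provable₁-⊕₁ A B a)
    ... | inj₂ (G , refl , a) = pair (provable₂-⊕₁ G A B a)
    rule _ (inst-⊕₂ Γ A B) (h ∷ []) with accepted-snoc Γ h
    ... | inj₁ (refl , b)     = single (provable₁-⊕₂ A B b)
    ... | inj₂ (G , refl , b) = pair (provable₂-⊕₂ G A B b)
    rule _ (inst-par Γ A B) (h ∷ []) with refl , t ← accepted-pair Γ h = single (provable₁-par A B t)
    rule _ (inst-C Γ A)     (h ∷ []) with refl , t ← accepted-pair Γ h = single (provable₁-C A t)

Q-count : ℕ → ℤ
Q-count x = if x ≡ᵇ 1 then 1ℤ else 0ℤ

charge : Literal → ℤ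
charge (pos x) = Q-count x
charge (neg x) = -ᶻ Q-count x

-- The possible Q-charges of a formula: ⊗ and par add the charges of their
-- parts, ⊕ takes that of either disjunct, and & only that of its right
-- conjunct, which suffices for (&) yet leaves Q̄, P ⋀ Q, P̄ ⋀ Q non-neutral.
data Charge : Formula → ℤ → Set where
  literal : ∀ l → Charge (lit l) (charge l)
  ⋀-both  : ∀ {a b} → Charge A a → Charge B b → Charge (A ⋀ B) (a +ᶻ b)
  ⋀-right : ∀ {b} → Charge B b → Charge (A ⋀ B) b
  ⋁-both  : ∀ {a b} → Charge A a → Charge B b → Charge (A ⋁ B) (a +ᶻ b)
  ⋁-left  : ∀ {a} → Charge A a → Charge (A ⋁ B) a
  ⋁-right : ∀ {b} → Charge B b → Charge (A ⋁ B) b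

data Charges : Sequent → ℤ → Set where
  []  : Charges [] 0ℤ
  _∷_ : ∀ {a k} → Charge A a → Charges Γ k → Charges (A ∷ Γ) (a +ᶻ k)

private
  exchange : ∀ a b k → a +ᶻ (b +ᶻ k) ≡ b +ᶻ (a +ᶻ k)
  exchange = solve-∀ᶻ

  reassoc : ∀ a b → a +ᶻ (b +ᶻ 0ℤ) ≡ (a +ᶻ b) +ᶻ 0ℤ
  reassoc = solve-∀ᶻ

  cancel : ∀ a → a +ᶻ (-ᶻ a +ᶻ 0ℤ) ≡ 0ℤ
  cancel = solve-∀ᶻ

Charges-resp-↭ : ∀ {k} → Γ ↭ Δ → Charges Γ k → Charges Δ k
Charges-resp-↭ refl         cs                             = cs
Charges-resp-↭ (prep _ p)   (c ∷ cs)                       = c ∷ Charges-resp-↭ p cs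
Charges-resp-↭ (swap _ _ p) (_∷_ {a = a} c (_∷_ {a = b} {k = k} d cs)) =
  subst (Charges _) (exchange b a k) (d ∷ c ∷ Charges-resp-↭ p cs)
Charges-resp-↭ (trans p q)  cs                             = Charges-resp-↭ q (Charges-resp-↭ p cs)

Charges-last : ∀ Γ {X Y : Formula} {k} → (∀ {a} → Charge X a → Charge Y a) →
               Charges (Γ ++ [ X ]) k → Charges (Γ ++ [ Y ]) k
Charges-last []      f (c ∷ []) = f c ∷ []
Charges-last (_ ∷ Γ) f (c ∷ cs) = c ∷ Charges-last Γ f cs

Charges-par : ∀ Γ {k} → Charges (Γ ++ A ∷ B ∷ []) k → Charges (Γ ++ [ A ⋁ B ]) k
Charges-par []      (_∷_ {a = a} c (_∷_ {a = b} d [])) =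
  subst (Charges _) (sym (reassoc a b)) (⋁-both c d ∷ [])
Charges-par (_ ∷ Γ) (c ∷ cs)                   = c ∷ Charges-par Γ cs

Charges-⊗ʳ : ∀ Σ {a j} → Charge A a → Charges (Σ ++ [ B ]) j → Charges (Σ ++ [ A ⋀ B ]) (a +ᶻ j)
Charges-⊗ʳ []      {a} c (_∷_ {a = b} d [])      = subst (Charges _) (sym (reassoc a b)) (⋀-both c d ∷ [])
Charges-⊗ʳ (_ ∷ Σ) {a} c (_∷_ {a = b} {k = j} d ds) =
  subst (Charges _) (exchange b a j) (d ∷ Charges-⊗ʳ Σ c ds)

Charges-⊗ : ∀ Δ Σ {i j} → Charges (Δ ++ [ A ]) i → Charges (Σ ++ [ B ]) j →
            Charges (Δ ++ Σ ++ [ A ⋀ B ]) (i +ᶻ j)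
Charges-⊗ []      Σ {j = j} (_∷_ {a = a} c [])      ds =
  subst (Charges _) (cong (_+ᶻ j) (sym (ℤ.+-identityʳ a))) (Charges-⊗ʳ Σ c ds)
Charges-⊗ (_ ∷ Δ) Σ {j = j} (_∷_ {a = a} {k = i} c cs) ds =
  subst (Charges _) (sym (ℤ.+-assoc a i j)) (c ∷ Charges-⊗ Δ Σ cs ds)

Q̄-Q′-charge : ∀ {k} → Charges (Q̄ ∷ (P ⋀ Q) ∷ (P̄ ⋀ Q) ∷ []) k → k ≡ 1ℤ
Q̄-Q′-charge (literal _ ∷ ⋀-both (literal _) (literal _) ∷ ⋀-both (literal _) (literal _) ∷ []) = refl
Q̄-Q′-charge (literal _ ∷ ⋀-both (literal _) (literal _) ∷ ⋀-right (literal _) ∷ [])             = refl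
Q̄-Q′-charge (literal _ ∷ ⋀-right (literal _) ∷ ⋀-both (literal _) (literal _) ∷ [])             = refl
Q̄-Q′-charge (literal _ ∷ ⋀-right (literal _) ∷ ⋀-right (literal _) ∷ [])                         = refl

-- Without (C), (W), (∧), the sequent Q′ ⋁ Q̄ can only be concluded from Q′, Q̄
-- by (par) or from non-tautologies by (⊕), and Q′, Q̄ only from the
-- non-neutral Q̄, P ⋀ Q, P̄ ⋀ Q or from non-tautologies.
record NeutralTautology (Γ : Sequent) : Set where
  field
    tautology : Tautology Γ
    neutral   : Charges Γ 0ℤ
    ≁Q′Q̄  : ¬ (Γ ↭ Q′ ∷ Q̄ ∷ [])
    ≁Q′⋁Q̄ : ¬ (Γ ↭ [ Q′ ⋁ Q̄ ])

principal-Q′ : ∀ Γ → Γ ++ [ A ⋁ B ] ↭ Q′ ∷ Q̄ ∷ [] → A ≡ P ⋀ Q × B ≡ P̄ ⋀ Q × Γ ↭ [ Q̄ ]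
principal-Q′ Γ q with ∈-resp-↭ q (∈-++⁺ʳ Γ (here refl))
... | here refl = refl , refl , drop-last q
... | there (here ())
... | there (there ())

principal-Q′⋁Q̄ : ∀ Γ → Γ ++ [ A ⋁ B ] ↭ [ Q′ ⋁ Q̄ ] → Γ ≡ [] × A ≡ Q′ × B ≡ Q̄
principal-Q′⋁Q̄ Γ q with refl , refl ← ∷ʳ-injective Γ [] (↭-singleton-inv q) = refl , refl , refl

⋀∉Q′Q̄ : A ⋀ B ∈ Γ → ¬ (Γ ↭ Q′ ∷ Q̄ ∷ [])
⋀∉Q′Q̄ m q with ∈-resp-↭ q m
... | here ()
... | there (here ())
... | there (there ())

⋀∉Q′⋁Q̄ : A ⋀ B ∈ Γ → ¬ (Γ ↭ [ Q′ ⋁ Q̄ ])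
⋀∉Q′⋁Q̄ m q with ∈-resp-↭ q m
... | here ()
... | there ()

private
  ρ₀₁ ρ⊤ ρ⊥ : ℕ → Bool
  ρ₀₁ x = x ≡ᵇ 1
  ρ⊤ _  = true
  ρ⊥ _  = false

open NeutralTautology

neutral-& : Preserves &r NeutralTautology
neutral-& i@(inst-& Γ A B) ns@(_ ∷ n ∷ []) = record
  { tautology = rule-tautology i (All.map tautology ns)
  ; neutral   = Charges-last Γ ⋀-right (neutral n)
  ; ≁Q′Q̄      = ⋀∉Q′Q̄ (∈-++⁺ʳ Γ (here refl))
  ; ≁Q′⋁Q̄     = ⋀∉Q′⋁Q̄ (∈-++⁺ʳ Γ (here refl))
  }

neutral-⊗ : Preserves ⊗r NeutralTautology
neutral-⊗ i@(inst-⊗ Δ Σ A B) ns@(n₁ ∷ n₂ ∷ []) = record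
  { tautology = rule-tautology i (All.map tautology ns)
  ; neutral   = Charges-⊗ Δ Σ (neutral n₁) (neutral n₂)
  ; ≁Q′Q̄      = ⋀∉Q′Q̄ (∈-++⁺ʳ Δ (∈-++⁺ʳ Σ (here refl)))
  ; ≁Q′⋁Q̄     = ⋀∉Q′⋁Q̄ (∈-++⁺ʳ Δ (∈-++⁺ʳ Σ (here refl)))
  }

neutral-⊕ : Preserves ⊕r NeutralTautology
neutral-⊕ i@(inst-⊕₁ Γ A B) ns@(n ∷ []) = record
  { tautology = rule-tautology i (All.map tautology ns)
  ; neutral   = Charges-last Γ ⋁-left (neutral n)
  ; ≁Q′Q̄      = λ q → case principal-Q′ Γ q of λ { (refl , refl , p) →
                  All¬⇒¬Any ((λ ()) ∷ (λ ()) ∷ []) (Any-resp-↭ (++⁺ʳ _ p) (tautology n ρ₀₁)) }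
  ; ≁Q′⋁Q̄     = λ q → case principal-Q′⋁Q̄ Γ q of λ { (refl , refl , refl) →
                  All¬⇒¬Any ((λ ()) ∷ []) (tautology n ρ⊥) }
  }
neutral-⊕ i@(inst-⊕₂ Γ A B) ns@(n ∷ []) = record
  { tautology = rule-tautology i (All.map tautology ns)
  ; neutral   = Charges-last Γ ⋁-right (neutral n)
  ; ≁Q′Q̄      = λ q → case principal-Q′ Γ q of λ { (refl , refl , p) →
                  All¬⇒¬Any ((λ ()) ∷ (λ ()) ∷ []) (Any-resp-↭ (++⁺ʳ _ p) (tautology n ρ⊤)) }
  ; ≁Q′⋁Q̄     = λ q → case principal-Q′⋁Q̄ Γ q of λ { (refl , refl , refl) →
                  All¬⇒¬Any ((λ ()) ∷ []) (tautology n ρ⊤) }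
  }

neutral-par : Preserves par NeutralTautology
neutral-par i@(inst-par Γ A B) ns@(n ∷ []) = record
  { tautology = rule-tautology i (All.map tautology ns)
  ; neutral   = Charges-par Γ (neutral n)
  ; ≁Q′Q̄      = λ q → case principal-Q′ Γ q of λ { (refl , refl , p) →
                  case Q̄-Q′-charge (Charges-resp-↭ (++⁺ʳ _ p) (neutral n)) of λ () }
  ; ≁Q′⋁Q̄     = λ q → case principal-Q′⋁Q̄ Γ q of λ { (refl , refl , refl) → ≁Q′Q̄ n ↭-refl }
  }

neutral-tautology : S C ≡ false → S W ≡ false → S ∧r ≡ false → Invariant S NeutralTautology
neutral-tautology {S} no-C no-W no-∧ = record
  { resp-↭ = λ p n → record
      { tautology = Tautology-resp-↭ p (tautology n)
      ; neutral   = Charges-resp-↭ p (neutral n)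
      ; ≁Q′Q̄      = ≁Q′Q̄ n ∘ trans p
      ; ≁Q′⋁Q̄     = ≁Q′⋁Q̄ n ∘ trans p
      }
  ; axiom  = λ x → record
      { tautology = axiom-tautology x
      ; neutral   = subst (Charges _) (cancel (Q-count x)) (literal _ ∷ literal _ ∷ [])
      ; ≁Q′Q̄      = λ q → case ↭-pair-inv q of λ { (inj₁ ()) ; (inj₂ ()) }
      ; ≁Q′⋁Q̄     = λ q → case ↭-length q of λ ()
      }
  ; rule   = rule
  }
  where
    rule : S r ≡ true → Preserves r NeutralTautology
    rule {C}   on = absent no-C on
    rule {W}   on = absent no-W on
    rule {∧r}  on = absent no-∧ on
    rule {&r}  _  = neutral-&
    rule {⊗r}  _  = neutral-⊗
    rule {⊕r}  _  = neutral-⊕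
    rule {par} _  = neutral-par

-- Systems not containing Mp are incomplete

P⋁P̄-valid : Valid (P ⋁ P̄)
P⋁P̄-valid ρ with ρ 0
... | true  = refl
... | false = refl

[P⋁P̄]⋁Q-valid : Valid ((P ⋁ P̄) ⋁ Q)
[P⋁P̄]⋁Q-valid ρ with ρ 0
... | true  = refl
... | false = refl

[P⋁P̄]⋀[P⋁P̄]-valid : Valid ((P ⋁ P̄) ⋀ (P ⋁ P̄))
[P⋁P̄]⋀[P⋁P̄]-valid ρ with ρ 0
... | true  = refl
... | false = refl

P̄⋁[P⋀P]-valid : Valid (P̄ ⋁ (P ⋀ P))
P̄⋁[P⋀P]-valid ρ with ρ 0
... | true  = refl
... | false = refl

Q′⋁Q̄-valid : Valid (Q′ ⋁ Q̄)
Q′⋁Q̄-valid ρ with ρ 0 | ρ 1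
... | true  | true  = refl
... | true  | false = refl
... | false | true  = refl
... | false | false = refl

module _ {S : System} where

  no-par-no-C⇒incomplete : S par ≡ false → S C ≡ false → ¬ Complete S
  no-par-no-C⇒incomplete no-par no-C cpl =
    case Invariant.holds (length≥2 no-par no-C) (cpl (P ⋁ P̄) P⋁P̄-valid) of λ { (s≤s ()) }

  no-par-no-⊕⇒incomplete : S par ≡ false → S ⊕r ≡ false → ¬ Complete S
  no-par-no-⊕⇒incomplete no-par no-⊕ cpl =
    case Invariant.holds (some-non-⋁ no-par no-⊕) (cpl (P ⋁ P̄) P⋁P̄-valid) of λ { (here n) → n _ }

  no-⊕-no-W⇒incomplete : S ⊕r ≡ false → S W ≡ false → ¬ Complete S
  no-⊕-no-W⇒incomplete no-⊕ no-W cpl =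
    Paired.neg-occurs
      (Invariant.holds (occurrences-paired no-⊕ no-W) (cpl ((P ⋁ P̄) ⋁ Q) [P⋁P̄]⋁Q-valid)) 1 _

  no-∧-⊗-&⇒incomplete : S ∧r ≡ false → S ⊗r ≡ false → S &r ≡ false → ¬ Complete S
  no-∧-⊗-&⇒incomplete no-∧ no-⊗ no-& cpl =
    case Invariant.holds (some-non-⋀ no-∧ no-⊗ no-&) (cpl ((P ⋁ P̄) ⋀ (P ⋁ P̄)) [P⋁P̄]⋀[P⋁P̄]-valid)
    of λ { (here n) → n _ }

  no-∧-&-C⇒incomplete : S ∧r ≡ false → S &r ≡ false → S C ≡ false → ¬ Complete S
  no-∧-&-C⇒incomplete no-∧ no-& no-C cpl =
    case Invariant.holds (łukasiewicz no-∧ no-& no-C) (cpl (P̄ ⋁ (P ⋀ P)) P̄⋁[P⋀P]-valid) of λ { (s≤s ()) }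

  no-∧-⊗-W⇒incomplete : S ∧r ≡ false → S ⊗r ≡ false → S W ≡ false → ¬ Complete S
  no-∧-⊗-W⇒incomplete no-∧ no-⊗ no-W cpl
    with Invariant.holds (short-accepted no-⊗ no-W no-∧) (cpl (Q′ ⋁ Q̄) Q′⋁Q̄-valid)
  ... | inj₁ (_ , p , t) with refl ← ↭-singleton-inv (↭-sym p) = t
  ... | inj₂ (_ , _ , p , _) = case ↭-length p of λ ()

  no-∧-C-W⇒incomplete : S ∧r ≡ false → S C ≡ false → S W ≡ false → ¬ Complete S
  no-∧-C-W⇒incomplete no-∧ no-C no-W cpl =
    ≁Q′⋁Q̄ (Invariant.holds (neutral-tautology no-C no-W no-∧) (cpl (Q′ ⋁ Q̄) Q′⋁Q̄-valid)) ↭-refl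

  complete⇒par : Complete S → DerivableRule S par
  complete⇒par cpl with S par in on | S ⊕r in on⊕ | S C in onC
  ... | true  | _     | _     = rule⇒derivable on
  ... | false | true  | true  = ⊕+C⇒par on⊕ onC
  ... | false | true  | false = ⊥-elim (no-par-no-C⇒incomplete on onC cpl)
  ... | false | false | _     = ⊥-elim (no-par-no-⊕⇒incomplete on on⊕ cpl)

  complete⇒⊕ : Complete S → DerivableRule S ⊕r
  complete⇒⊕ cpl with S ⊕r in on | S W in onW | S par in onPar
  ... | true  | _     | _     = rule⇒derivable on
  ... | false | true  | true  = W+par⇒⊕ onW onPar
  ... | false | true  | false = ⊥-elim (no-par-no-⊕⇒incomplete onPar on cpl)
  ... | false | false | _     = ⊥-elim (no-⊕-no-W⇒incomplete on onW cpl)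

  complete⇒∧ : Complete S → DerivableRule S ∧r
  complete⇒∧ cpl with S ∧r in on | S ⊗r in on⊗ | S &r in on& | S C in onC | S W in onW
  ... | true  | _     | _     | _     | _     = rule⇒derivable on
  ... | false | true  | _     | true  | _     = ⊗+C⇒∧ on⊗ onC
  ... | false | _     | true  | _     | true  = &+W⇒∧ on& onW
  ... | false | false | false | _     | _     = ⊥-elim (no-∧-⊗-&⇒incomplete on on⊗ on& cpl)
  ... | false | true  | false | false | _     = ⊥-elim (no-∧-&-C⇒incomplete on on& onC cpl)
  ... | false | true  | true  | false | false = ⊥-elim (no-∧-C-W⇒incomplete on onC onW cpl)
  ... | false | false | true  | _     | false = ⊥-elim (no-∧-⊗-W⇒incomplete on on⊗ onW cpl)

theorem20 : (S : System) → Complete S ⇔ Contains S Mp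
theorem20 S = mk⇔ complete⇒contains-Mp contains-Mp⇒complete
  where
    complete⇒contains-Mp : Complete S → Contains S Mp
    complete⇒contains-Mp cpl ∧r  _ = complete⇒∧ cpl
    complete⇒contains-Mp cpl ⊕r  _ = complete⇒⊕ cpl
    complete⇒contains-Mp cpl par _ = complete⇒par cpl
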